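{- Let $\mathbf{u}\in Q$, $\alpha\in\Lambda_{\mathbf{u}}$ and $k\in\mathbb{Z}_{\ge0}$. Then $$\#\{\mathbf{v}\in\pi_{\mathbf{u}}^{ -1}(\alpha)\cap Q:|\mathbf{v}|=q^k|\mathbf{u}|\}\le(q-1)q^k.$$ Moreover, if $\alpha$ is primitive in $\Lambda_{\mathbf{u}}$, then equality holds.
   Context: $q$ a prime power, $\mathcal{R}=\mathbb{F}_q[x]$, $\mathcal{K}=\mathbb{F}_q(x)$ with $|f/g|=q^{\deg f-\deg g}$, $\widetilde{\mathcal{K}}=\mathbb{F}_q((x^{ -1}))$ its completion. $Q=\{(a_1,\dots,a_d,b)\in\mathcal{R}^{d+1}:\gcd(a_1,\dots,a_d,b)=1,\ b\neq0\}$; for $\mathbf{u}=(\mathbf{a},b)\in Q$, $\hat{\mathbf{u}}=\mathbf{a}/b$, $|\mathbf{u}|=|b|$. $\pi_{\mathbf{u}}:\widetilde{\mathcal{K}}^d\times\widetilde{\mathcal{K}}\to\widetilde{\mathcal{K}}^d$, $\pi_{\mathbf{u}}(\mathbf{a}',b')=b'\hat{\mathbf{u}}-\mathbf{a}'$, and $\Lambda_{\mathbf{u}}=\pi_{\mathbf{u}}(\mathcal{R}^{d+1})$. An element $\alpha\in\Lambda_{\mathbf{u}}$ is primitive if $\alpha\neq0$ and $\alpha$ cannot be written as $s\beta$ with $\beta\in\Lambda_{\mathbf{u}}$ and $s\in\mathcal{R}$, $|s|>1$. -}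

module Defs where

open import Level using (0ℓ)
open import Algebra.Bundles using (CommutativeRing)
open import Data.Nat using (ℕ; zero; suc; _≤_)
import Data.Nat as ℕ
open import Data.Fin using (Fin)
open import Data.List using (List; []; _∷_; map; length)
open import Data.List.Relation.Unary.All using (All)
open import Data.List.Relation.Unary.Any using (Any)
open import Data.List.Relation.Unary.AllPairs using (AllPairs)
open import Data.Product using (Σ; _×_; _,_; proj₁; proj₂)
open import Data.Sum using (_⊎_)
open import Data.Unit using (⊤)
open import Relation.Nullary using (¬_)
open import Relation.Binary.PropositionalEquality using (_≡_)

-- "#{x : P x} ≤ N": any list of pairwise distinct elements satisfying P
-- has length at most N.
CardLE : {A : Set} → (A → A → Set) → (A → Set) → ℕ → Set
CardLE {A} _≈_ P N =
  (xs : List A) → All P xs → AllPairs (λ x y → ¬ (x ≈ y)) xs → length xs ≤ N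

-- "#{x : P x} = N": there is a list of exactly N pairwise distinct
-- elements satisfying P, and every element satisfying P is (≈) in it.
CardEq : {A : Set} → (A → A → Set) → (A → Set) → ℕ → Set
CardEq {A} _≈_ P N =
  Σ (List A) λ xs → All P xs × AllPairs (λ x y → ¬ (x ≈ y)) xs
    × ((x : A) → P x → Any (λ y → x ≈ y) xs) × length xs ≡ N

-- Fields (agda-stdlib has no Field bundle): a commutative ring with
-- 1 ≠ 0 in which every nonzero element has a multiplicative inverse.

record IsFieldCR (F : CommutativeRing 0ℓ 0ℓ) : Set where
  open CommutativeRing F
  field
    1≉0 : ¬ (1# ≈ 0#)
    inverse : (x : Carrier) → ¬ (x ≈ 0#) → Σ Carrier λ y → (x * y) ≈ 1#

HasCard : CommutativeRing 0ℓ 0ℓ → ℕ → Set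
HasCard F q = CardEq (CommutativeRing._≈_ F) (λ _ → ⊤) q

module Over (F : CommutativeRing 0ℓ 0ℓ) where
  open CommutativeRing F renaming (Carrier to A)

  -- Polynomials F[x] as coefficient lists, lowest degree first.
  Poly : Set
  Poly = List A

  coeff : Poly → ℕ → A
  coeff [] n = 0#
  coeff (a ∷ p) zero = a
  coeff (a ∷ p) (suc n) = coeff p n

  _≈ₚ_ : Poly → Poly → Set
  p ≈ₚ r = (n : ℕ) → coeff p n ≈ coeff r n

  0ₚ : Poly
  0ₚ = []

  1ₚ : Poly
  1ₚ = 1# ∷ []

  _+ₚ_ : Poly → Poly → Poly
  [] +ₚ r = r
  (a ∷ p) +ₚ [] = a ∷ p
  (a ∷ p) +ₚ (b ∷ r) = (a + b) ∷ (p +ₚ r)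

  -ₚ_ : Poly → Poly
  -ₚ p = map -_ p

  _-ₚ_ : Poly → Poly → Poly
  p -ₚ r = p +ₚ (-ₚ r)

  _*ₚ_ : Poly → Poly → Poly
  [] *ₚ r = []
  (a ∷ p) *ₚ r = map (a *_) r +ₚ (0# ∷ (p *ₚ r))

  _∣ₚ_ : Poly → Poly → Set
  c ∣ₚ p = Σ Poly λ e → p ≈ₚ (c *ₚ e)

  HasDegree : Poly → ℕ → Set
  HasDegree p n = ¬ (coeff p n ≈ 0#) × ((m : ℕ) → n ℕ.< m → coeff p m ≈ 0#)

  -- Norm q p r  :⇔  |p| = r, where |p| = q ^ deg p and |0| = 0.
  Norm : ℕ → Poly → ℕ → Set
  Norm q p r = (p ≈ₚ 0ₚ × r ≡ 0) ⊎ Σ ℕ λ n → HasDegree p n × r ≡ q ℕ.^ n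

  -- R^{d+1}, written as pairs (a , b) with a ∈ R^d, b ∈ R.
  Rd : ℕ → Set
  Rd d = (Fin d → Poly) × Poly

  _≈R_ : {d : ℕ} → Rd d → Rd d → Set
  v ≈R w = ((i : _) → proj₁ v i ≈ₚ proj₁ w i) × (proj₂ v ≈ₚ proj₂ w)

  -- gcd(a_1,…,a_d,b) = 1: every common divisor is a unit (divides 1).
  CoprimeTuple : {d : ℕ} → Rd d → Set
  CoprimeTuple (a , b) =
    (c : Poly) → ((i : _) → c ∣ₚ a i) → c ∣ₚ b → c ∣ₚ 1ₚ

  InQ : {d : ℕ} → Rd d → Set
  InQ v = CoprimeTuple v × ¬ (proj₂ v ≈ₚ 0ₚ)

  -- Elements of K = F(x): fractions with nonzero denominator.
  record K : Set where
    constructor _/_∶_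
    field
      num : Poly
      den : Poly
      den≉0 : ¬ (den ≈ₚ 0ₚ)
  open K public

  _≈K_ : K → K → Set
  x ≈K y = (num x *ₚ den y) ≈ₚ (num y *ₚ den x)

  IsZeroK : K → Set
  IsZeroK x = num x ≈ₚ 0ₚ

  _•_ : Poly → K → K
  s • x = (s *ₚ num x) / den x ∶ den≉0 x

  _−ι_ : K → Poly → K
  x −ι a = (num x -ₚ (a *ₚ den x)) / den x ∶ den≉0 x

  Kd : ℕ → Set
  Kd d = Fin d → K

  hat : {d : ℕ} (u : Rd d) → InQ u → Kd d
  hat (a , b) uQ i = a i / b ∶ proj₂ uQ

  π : {d : ℕ} (u : Rd d) → InQ u → Rd d → Kd d
  π u uQ (a' , b') i = (b' • hat u uQ i) −ι a' i

  InΛ : {d : ℕ} (u : Rd d) → InQ u → Kd d → Set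
  InΛ u uQ α = Σ (Rd _) λ w → (i : _) → π u uQ w i ≈K α i

  Primitive : ℕ → {d : ℕ} (u : Rd d) → InQ u → Kd d → Set
  Primitive q {d} u uQ α =
    ¬ ((i : Fin d) → IsZeroK (α i))
    × ¬ (Σ (Kd d) λ β → InΛ u uQ β
          × Σ Poly λ s → (Σ ℕ λ r → Norm q s r × 1 ℕ.< r)
          × ((i : Fin d) → α i ≈K (s • β i)))

  Fiber : ℕ → {d : ℕ} (u : Rd d) → InQ u → Kd d → ℕ → Rd d → Set
  Fiber q u uQ α k v =
    InQ v × ((i : _) → π u uQ v i ≈K α i)
    × Σ ℕ λ r → Norm q (proj₂ u) r × Norm q (proj₂ v) (q ℕ.^ k ℕ.* r)

{-# OPTIONS --safe #-}
-- Integral preimages of α form a coset w + F[x] u: if π_u(v) = π_u(w), then b divides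
-- (b_v − b_w) aᵢ for every i, and since gcd(a, b) = 1 this forces b ∣ b_v − b_w (the s with
-- b ∣ s aᵢ for all i form an ideal containing b, which a Euclidean argument shows to be b F[x]).
-- Choosing w with deg b_w < deg b, the last coordinate b_w + t b of w + t u has degree
-- deg t + deg b, so the v with |v| = q^k |u| are exactly the w + t u with deg t = k, and there
-- are (q − 1) q^k such t.  When α is primitive they all lie in Q: a common divisor c of w + t u
-- of positive degree would give α = c · π_u((w + t u) / c) with |c| > 1.
module Submission where

open import Level using (0ℓ)
open import Algebra.Bundles using (CommutativeRing)
open import Data.Nat using (ℕ)
open import Relation.Binary.Definitions using (Decidable)
open import Defs

module CommutativeRingSolver (R : CommutativeRing 0ℓ 0ℓ) where
  open import Data.Nat as ℕ using (zero; suc)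
  open import Data.Integer as ℤ using (ℤ; +_; -[1+_]; _⊖_; _◃_; ∣_∣; sign)
  import Data.Integer.Properties as ℤ
  open import Data.Sign as Sign using (Sign)
  open import Data.Maybe using (Maybe; just; nothing)
  open import Relation.Nullary using (yes; no)
  import Relation.Binary.PropositionalEquality as ≡
  import Algebra.Solver.Ring.AlmostCommutativeRing as ACR

  open CommutativeRing R
  open import Algebra.Properties.Ring ring
  open import Algebra.Properties.Semiring.Mult semiring
  open import Relation.Binary.Reasoning.Setoid setoid

  private
    signed : Sign → Carrier → Carrier
    signed Sign.+ x = x
    signed Sign.- x = - x

    signed-cong : ∀ s {x y} → x ≈ y → signed s x ≈ signed s y
    signed-cong Sign.+ x≈y = x≈y
    signed-cong Sign.- x≈y = -‿cong x≈y

    signed-* : ∀ s t x y → signed (s Sign.* t) (x * y) ≈ signed s x * signed t y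
    signed-* Sign.+ Sign.+ x y = refl
    signed-* Sign.+ Sign.- x y = -‿distribʳ-* x y
    signed-* Sign.- Sign.+ x y = -‿distribˡ-* x y
    signed-* Sign.- Sign.- x y = begin
      x * y           ≈⟨ -‿involutive _ ⟨
      - - (x * y)     ≈⟨ -‿cong (-‿distribʳ-* x y) ⟩
      - (x * - y)     ≈⟨ -‿distribˡ-* x (- y) ⟩
      - x * - y       ∎

    [1+x]-[1+y]≈x-y : ∀ x y → (1# + x) - (1# + y) ≈ x - y
    [1+x]-[1+y]≈x-y x y = begin
      (1# + x) + - (1# + y)      ≈⟨ +-congˡ (-‿+-comm 1# y) ⟨
      (1# + x) + (- 1# + - y)    ≈⟨ +-congʳ (+-comm 1# x) ⟩
      (x + 1#) + (- 1# + - y)    ≈⟨ +-assoc x 1# _ ⟩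
      x + (1# + (- 1# + - y))    ≈⟨ +-congˡ (+-assoc 1# (- 1#) (- y)) ⟨
      x + ((1# - 1#) + - y)      ≈⟨ +-congˡ (+-congʳ (-‿inverseʳ 1#)) ⟩
      x + (0# + - y)             ≈⟨ +-congˡ (+-identityˡ _) ⟩
      x - y                      ∎

    fromℤ : ℤ → Carrier
    fromℤ (+ n) = n × 1#
    fromℤ -[1+ n ] = - (suc n × 1#)

    fromℤ-⊖ : ∀ m n → fromℤ (m ⊖ n) ≈ m × 1# - n × 1#
    fromℤ-⊖ zero zero = sym (-‿inverseʳ 0#)
    fromℤ-⊖ zero (suc n) = sym (+-identityˡ _)
    fromℤ-⊖ (suc m) zero = sym (trans (+-congˡ -0#≈0#) (+-identityʳ _))
    fromℤ-⊖ (suc m) (suc n) = begin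
      fromℤ (suc m ⊖ suc n)      ≡⟨ ≡.cong fromℤ (ℤ.[1+m]⊖[1+n]≡m⊖n m n) ⟩
      fromℤ (m ⊖ n)              ≈⟨ fromℤ-⊖ m n ⟩
      m × 1# - n × 1#            ≈⟨ [1+x]-[1+y]≈x-y _ _ ⟨
      suc m × 1# - suc n × 1#    ∎

    fromℤ-◃ : ∀ s n → fromℤ (s ◃ n) ≈ signed s (n × 1#)
    fromℤ-◃ Sign.- zero = sym -0#≈0#
    fromℤ-◃ Sign.+ zero = refl
    fromℤ-◃ Sign.- (suc n) = refl
    fromℤ-◃ Sign.+ (suc n) = refl

    fromℤ-sign-abs : ∀ i → fromℤ i ≈ signed (sign i) (∣ i ∣ × 1#)
    fromℤ-sign-abs (+ zero) = refl
    fromℤ-sign-abs (+ suc n) = refl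
    fromℤ-sign-abs -[1+ n ] = refl

    fromℤ-+ : ∀ i j → fromℤ (i ℤ.+ j) ≈ fromℤ i + fromℤ j
    fromℤ-+ (+ m) (+ n) = ×-homo-+ 1# m n
    fromℤ-+ (+ m) -[1+ n ] = fromℤ-⊖ m (suc n)
    fromℤ-+ -[1+ m ] (+ n) = trans (fromℤ-⊖ n (suc m)) (+-comm _ _)
    fromℤ-+ -[1+ m ] -[1+ n ] = begin
      - (suc (suc m ℕ.+ n) × 1#)               ≈⟨ -‿cong (+-congˡ (×-homo-+ 1# (suc m) n)) ⟩
      - (1# + (suc m × 1# + n × 1#))           ≈⟨ -‿cong (+-assoc 1# _ _) ⟨
      - ((1# + suc m × 1#) + n × 1#)           ≈⟨ -‿cong (+-congʳ (+-comm 1# _)) ⟩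
      - ((suc m × 1# + 1#) + n × 1#)           ≈⟨ -‿cong (+-assoc _ 1# _) ⟩
      - (suc m × 1# + suc n × 1#)              ≈⟨ -‿+-comm _ _ ⟨
      - (suc m × 1#) + - (suc n × 1#)          ∎

    fromℤ-* : ∀ i j → fromℤ (i ℤ.* j) ≈ fromℤ i * fromℤ j
    fromℤ-* i j = begin
      fromℤ ((sign i Sign.* sign j) ◃ (∣ i ∣ ℕ.* ∣ j ∣))
        ≈⟨ fromℤ-◃ (sign i Sign.* sign j) (∣ i ∣ ℕ.* ∣ j ∣) ⟩
      signed (sign i Sign.* sign j) ((∣ i ∣ ℕ.* ∣ j ∣) × 1#)
        ≈⟨ signed-cong (sign i Sign.* sign j) (×1-homo-* ∣ i ∣ ∣ j ∣) ⟩
      signed (sign i Sign.* sign j) (∣ i ∣ × 1# * ∣ j ∣ × 1#)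
        ≈⟨ signed-* (sign i) (sign j) _ _ ⟩
      signed (sign i) (∣ i ∣ × 1#) * signed (sign j) (∣ j ∣ × 1#)
        ≈⟨ *-cong (fromℤ-sign-abs i) (fromℤ-sign-abs j) ⟨
      fromℤ i * fromℤ j ∎

    fromℤ-neg : ∀ i → fromℤ (ℤ.- i) ≈ - fromℤ i
    fromℤ-neg (+ zero) = sym -0#≈0#
    fromℤ-neg (+ suc n) = refl
    fromℤ-neg -[1+ n ] = sym (-‿involutive _)

    almostRing : ACR.AlmostCommutativeRing 0ℓ 0ℓ
    almostRing = ACR.fromCommutativeRing R

    fromℤ-homomorphism : ACR._-Raw-AlmostCommutative⟶_ ℤ.+-*-rawRing almostRing
    fromℤ-homomorphism = record
      { ⟦_⟧ = fromℤ ; +-homo = fromℤ-+ ; *-homo = fromℤ-* ; -‿homo = fromℤ-neg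
      ; 0-homo = refl ; 1-homo = +-identityʳ 1# }

    fromℤ-≟ : (i j : ℤ) → Maybe (fromℤ i ≈ fromℤ j)
    fromℤ-≟ i j with i ℤ.≟ j
    ... | yes ≡.refl = just refl
    ... | no _ = nothing

  open import Algebra.Solver.Ring ℤ.+-*-rawRing almostRing fromℤ-homomorphism fromℤ-≟ public

module Polynomial (F : CommutativeRing 0ℓ 0ℓ) where

  open import Data.Nat using (zero; suc)
  open import Data.List using ([]; _∷_; map)
  open import Data.Product using (_,_)
  open import Relation.Binary.Bundles using (Setoid)
  import Relation.Binary.Reasoning.Setoid as SetoidReasoning

  open CommutativeRing F renaming (Carrier to A) hiding (zero)
  open Over F
  open import Algebra.Properties.Ring ring using (-0#≈0#)
  open CommutativeRingSolver F using (solve; _:=_; _:+_; _:*_)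

  infix 4 _≋_
  -- _≈ₚ_ wrapped in a record, so that both sides of an equation can be inferred.
  record _≋_ (p r : Poly) : Set where
    constructor mk≋
    field coeff-≈ : p ≈ₚ r
  open _≋_ public

  ≋-refl : ∀ {p} → p ≋ p
  ≋-refl = mk≋ λ _ → refl

  ≋-sym : ∀ {p r} → p ≋ r → r ≋ p
  ≋-sym e = mk≋ λ n → sym (coeff-≈ e n)

  ≋-trans : ∀ {p r s} → p ≋ r → r ≋ s → p ≋ s
  ≋-trans e f = mk≋ λ n → trans (coeff-≈ e n) (coeff-≈ f n)

  ≋-setoid : Setoid 0ℓ 0ℓ
  ≋-setoid = record
    { Carrier = Poly ; _≈_ = _≋_
    ; isEquivalence = record { refl = ≋-refl ; sym = ≋-sym ; trans = ≋-trans } }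

  private
    module ≈-Reasoning = SetoidReasoning setoid
    module ≋-Reasoning = SetoidReasoning ≋-setoid

  ∷-cong : ∀ {c c' p p'} → c ≈ c' → p ≋ p' → (c ∷ p) ≋ (c' ∷ p')
  ∷-cong c≈c' p≋p' = mk≋ λ { zero → c≈c' ; (suc n) → coeff-≈ p≋p' n }

  scale : A → Poly → Poly
  scale a = map (a *_)

  coeff-+ : ∀ p r n → coeff (p +ₚ r) n ≈ coeff p n + coeff r n
  coeff-+ [] r n = sym (+-identityˡ _)
  coeff-+ (a ∷ p) [] n = sym (+-identityʳ _)
  coeff-+ (a ∷ p) (b ∷ r) zero = refl
  coeff-+ (a ∷ p) (b ∷ r) (suc n) = coeff-+ p r n

  coeff-neg : ∀ p n → coeff (-ₚ p) n ≈ - coeff p n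
  coeff-neg [] n = sym -0#≈0#
  coeff-neg (a ∷ p) zero = refl
  coeff-neg (a ∷ p) (suc n) = coeff-neg p n

  coeff-scale : ∀ a p n → coeff (scale a p) n ≈ a * coeff p n
  coeff-scale a [] n = sym (zeroʳ _)
  coeff-scale a (b ∷ p) zero = refl
  coeff-scale a (b ∷ p) (suc n) = coeff-scale a p n

  coeff-∷-*-zero : ∀ a p r → coeff ((a ∷ p) *ₚ r) zero ≈ a * coeff r zero
  coeff-∷-*-zero a p r = trans (coeff-+ (scale a r) (0# ∷ (p *ₚ r)) zero)
                           (trans (+-identityʳ _) (coeff-scale a r zero))

  coeff-∷-*-suc : ∀ a p r n →
    coeff ((a ∷ p) *ₚ r) (suc n) ≈ a * coeff r (suc n) + coeff (p *ₚ r) n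
  coeff-∷-*-suc a p r n = trans (coeff-+ (scale a r) (0# ∷ (p *ₚ r)) (suc n))
                            (+-congʳ (coeff-scale a r (suc n)))

  +ₚ-cong : ∀ {p p' r r'} → p ≋ p' → r ≋ r' → (p +ₚ r) ≋ (p' +ₚ r')
  +ₚ-cong {p} {p'} {r} {r'} e f = mk≋ λ n →
    trans (coeff-+ p r n) (trans (+-cong (coeff-≈ e n) (coeff-≈ f n)) (sym (coeff-+ p' r' n)))

  -ₚ-cong : ∀ {p p'} → p ≋ p' → (-ₚ p) ≋ (-ₚ p')
  -ₚ-cong {p} {p'} e = mk≋ λ n →
    trans (coeff-neg p n) (trans (-‿cong (coeff-≈ e n)) (sym (coeff-neg p' n)))

  scale-cong : ∀ {a b p r} → a ≈ b → p ≋ r → scale a p ≋ scale b r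
  scale-cong {a} {b} {p} {r} a≈b e = mk≋ λ n →
    trans (coeff-scale a p n) (trans (*-cong a≈b (coeff-≈ e n)) (sym (coeff-scale b r n)))

  +ₚ-assoc : ∀ p r s → ((p +ₚ r) +ₚ s) ≋ (p +ₚ (r +ₚ s))
  +ₚ-assoc p r s = mk≋ λ n → begin
    coeff ((p +ₚ r) +ₚ s) n              ≈⟨ trans (coeff-+ (p +ₚ r) s n) (+-congʳ (coeff-+ p r n)) ⟩
    (coeff p n + coeff r n) + coeff s n  ≈⟨ +-assoc _ _ _ ⟩
    coeff p n + (coeff r n + coeff s n)  ≈⟨ trans (coeff-+ p (r +ₚ s) n) (+-congˡ (coeff-+ r s n)) ⟨
    coeff (p +ₚ (r +ₚ s)) n              ∎
    where open ≈-Reasoning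

  +ₚ-comm : ∀ p r → (p +ₚ r) ≋ (r +ₚ p)
  +ₚ-comm p r = mk≋ λ n → trans (coeff-+ p r n) (trans (+-comm _ _) (sym (coeff-+ r p n)))

  +ₚ-identityʳ : ∀ p → (p +ₚ 0ₚ) ≋ p
  +ₚ-identityʳ p = mk≋ λ n → trans (coeff-+ p [] n) (+-identityʳ _)

  -ₚ-inverseˡ : ∀ p → ((-ₚ p) +ₚ p) ≋ 0ₚ
  -ₚ-inverseˡ p = mk≋ λ n →
    trans (coeff-+ (-ₚ p) p n) (trans (+-congʳ (coeff-neg p n)) (-‿inverseˡ _))

  -ₚ-inverseʳ : ∀ p → (p +ₚ (-ₚ p)) ≋ 0ₚ
  -ₚ-inverseʳ p = mk≋ λ n →
    trans (coeff-+ p (-ₚ p) n) (trans (+-congˡ (coeff-neg p n)) (-‿inverseʳ _))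

  *ₚ-congʳ : ∀ p {r r'} → r ≋ r' → (p *ₚ r) ≋ (p *ₚ r')
  *ₚ-congʳ [] e = ≋-refl
  *ₚ-congʳ (a ∷ p) e = +ₚ-cong (scale-cong refl e) (∷-cong refl (*ₚ-congʳ p e))

  *ₚ-zeroʳ : ∀ p → (p *ₚ []) ≋ 0ₚ
  *ₚ-zeroʳ [] = ≋-refl
  *ₚ-zeroʳ (a ∷ p) = mk≋ λ { zero → refl ; (suc n) → coeff-≈ (*ₚ-zeroʳ p) n }

  *ₚ-distribʳ : ∀ r p s → ((p +ₚ s) *ₚ r) ≋ ((p *ₚ r) +ₚ (s *ₚ r))
  *ₚ-distribʳ r [] s = ≋-refl
  *ₚ-distribʳ r (a ∷ p) [] = ≋-sym (+ₚ-identityʳ ((a ∷ p) *ₚ r))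
  *ₚ-distribʳ r (a ∷ p) (b ∷ s) = mk≋ λ
    { zero → begin
        coeff (((a + b) ∷ (p +ₚ s)) *ₚ r) zero  ≈⟨ coeff-∷-*-zero (a + b) (p +ₚ s) r ⟩
        (a + b) * coeff r zero                  ≈⟨ distribʳ _ _ _ ⟩
        a * coeff r zero + b * coeff r zero     ≈⟨ +-cong (coeff-∷-*-zero a p r) (coeff-∷-*-zero b s r) ⟨
        coeff ((a ∷ p) *ₚ r) zero + coeff ((b ∷ s) *ₚ r) zero
                                                ≈⟨ coeff-+ ((a ∷ p) *ₚ r) ((b ∷ s) *ₚ r) zero ⟨
        coeff (((a ∷ p) *ₚ r) +ₚ ((b ∷ s) *ₚ r)) zero ∎
    ; (suc n) → begin
        coeff (((a + b) ∷ (p +ₚ s)) *ₚ r) (suc n)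
          ≈⟨ coeff-∷-*-suc (a + b) (p +ₚ s) r n ⟩
        (a + b) * coeff r (suc n) + coeff ((p +ₚ s) *ₚ r) n
          ≈⟨ +-congˡ (trans (coeff-≈ (*ₚ-distribʳ r p s) n) (coeff-+ (p *ₚ r) (s *ₚ r) n)) ⟩
        (a + b) * coeff r (suc n) + (coeff (p *ₚ r) n + coeff (s *ₚ r) n)
          ≈⟨ solve 5 (λ a b x y z → (a :+ b) :* x :+ (y :+ z) := (a :* x :+ y) :+ (b :* x :+ z))
                     refl a b (coeff r (suc n)) (coeff (p *ₚ r) n) (coeff (s *ₚ r) n) ⟩
        (a * coeff r (suc n) + coeff (p *ₚ r) n) + (b * coeff r (suc n) + coeff (s *ₚ r) n)
          ≈⟨ +-cong (coeff-∷-*-suc a p r n) (coeff-∷-*-suc b s r n) ⟨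
        coeff ((a ∷ p) *ₚ r) (suc n) + coeff ((b ∷ s) *ₚ r) (suc n)
          ≈⟨ coeff-+ ((a ∷ p) *ₚ r) ((b ∷ s) *ₚ r) (suc n) ⟨
        coeff (((a ∷ p) *ₚ r) +ₚ ((b ∷ s) *ₚ r)) (suc n) ∎ }
    where open ≈-Reasoning

  *ₚ-∷ʳ : ∀ p b r → (p *ₚ (b ∷ r)) ≋ (scale b p +ₚ (0# ∷ (p *ₚ r)))
  *ₚ-∷ʳ [] b r = mk≋ λ { zero → refl ; (suc n) → refl }
  *ₚ-∷ʳ (a ∷ p) b r = mk≋ λ
    { zero → begin
        coeff ((a ∷ p) *ₚ (b ∷ r)) zero   ≈⟨ coeff-∷-*-zero a p (b ∷ r) ⟩
        a * b                             ≈⟨ *-comm a b ⟩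
        b * a                             ≈⟨ +-identityʳ _ ⟨
        b * a + 0#                        ≈⟨ coeff-+ (scale b (a ∷ p)) (0# ∷ ((a ∷ p) *ₚ r)) zero ⟨
        coeff (scale b (a ∷ p) +ₚ (0# ∷ ((a ∷ p) *ₚ r))) zero ∎
    ; (suc n) → begin
        coeff ((a ∷ p) *ₚ (b ∷ r)) (suc n)
          ≈⟨ coeff-∷-*-suc a p (b ∷ r) n ⟩
        a * coeff r n + coeff (p *ₚ (b ∷ r)) n
          ≈⟨ +-congˡ (trans (coeff-≈ (*ₚ-∷ʳ p b r) n) (coeff-+ (scale b p) (0# ∷ (p *ₚ r)) n)) ⟩
        a * coeff r n + (coeff (scale b p) n + coeff (0# ∷ (p *ₚ r)) n)
          ≈⟨ solve 3 (λ x y z → x :+ (y :+ z) := y :+ (x :+ z)) refl _ _ _ ⟩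
        coeff (scale b p) n + (a * coeff r n + coeff (0# ∷ (p *ₚ r)) n)
          ≈⟨ +-congˡ (trans (coeff-+ (scale a r) (0# ∷ (p *ₚ r)) n) (+-congʳ (coeff-scale a r n))) ⟨
        coeff (scale b p) n + coeff ((a ∷ p) *ₚ r) n
          ≈⟨ coeff-+ (scale b (a ∷ p)) (0# ∷ ((a ∷ p) *ₚ r)) (suc n) ⟨
        coeff (scale b (a ∷ p) +ₚ (0# ∷ ((a ∷ p) *ₚ r))) (suc n) ∎ }
    where open ≈-Reasoning

  *ₚ-comm : ∀ p r → (p *ₚ r) ≋ (r *ₚ p)
  *ₚ-comm [] r = ≋-sym (*ₚ-zeroʳ r)
  *ₚ-comm (a ∷ p) r = begin
    scale a r +ₚ (0# ∷ (p *ₚ r))  ≈⟨ +ₚ-cong (≋-refl {scale a r}) (∷-cong refl (*ₚ-comm p r)) ⟩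
    scale a r +ₚ (0# ∷ (r *ₚ p))  ≈⟨ *ₚ-∷ʳ r a p ⟨
    r *ₚ (a ∷ p)                  ∎
    where open ≋-Reasoning

  *ₚ-congˡ : ∀ {p p'} r → p ≋ p' → (p *ₚ r) ≋ (p' *ₚ r)
  *ₚ-congˡ {p} {p'} r e = ≋-trans (*ₚ-comm p r) (≋-trans (*ₚ-congʳ r e) (*ₚ-comm r p'))

  *ₚ-cong : ∀ {p p' r r'} → p ≋ p' → r ≋ r' → (p *ₚ r) ≋ (p' *ₚ r')
  *ₚ-cong {p' = p'} {r = r} e f = ≋-trans (*ₚ-congˡ r e) (*ₚ-congʳ p' f)

  scale-+ₚ : ∀ a p r → scale a (p +ₚ r) ≋ (scale a p +ₚ scale a r)
  scale-+ₚ a p r = mk≋ λ n → begin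
    coeff (scale a (p +ₚ r)) n              ≈⟨ trans (coeff-scale a (p +ₚ r) n) (*-congˡ (coeff-+ p r n)) ⟩
    a * (coeff p n + coeff r n)             ≈⟨ distribˡ _ _ _ ⟩
    a * coeff p n + a * coeff r n           ≈⟨ trans (coeff-+ (scale a p) (scale a r) n)
                                                     (+-cong (coeff-scale a p n) (coeff-scale a r n)) ⟨
    coeff (scale a p +ₚ scale a r) n        ∎
    where open ≈-Reasoning

  scale-*ₚ : ∀ a r s → ((scale a r) *ₚ s) ≋ scale a (r *ₚ s)
  scale-*ₚ a [] s = ≋-refl
  scale-*ₚ a (b ∷ r) s = begin
    scale (a * b) s +ₚ (0# ∷ (scale a r *ₚ s))
      ≈⟨ +ₚ-cong scale-scale (∷-cong (sym (zeroʳ a)) (scale-*ₚ a r s)) ⟩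
    scale a (scale b s) +ₚ scale a (0# ∷ (r *ₚ s))
      ≈⟨ scale-+ₚ a (scale b s) (0# ∷ (r *ₚ s)) ⟨
    scale a (scale b s +ₚ (0# ∷ (r *ₚ s))) ∎
    where
    open ≋-Reasoning
    scale-scale : scale (a * b) s ≋ scale a (scale b s)
    scale-scale = mk≋ λ n → trans (coeff-scale (a * b) s n)
      (trans (*-assoc _ _ _) (sym (trans (coeff-scale a (scale b s) n) (*-congˡ (coeff-scale b s n)))))

  *ₚ-assoc : ∀ p r s → ((p *ₚ r) *ₚ s) ≋ (p *ₚ (r *ₚ s))
  *ₚ-assoc [] r s = ≋-refl
  *ₚ-assoc (a ∷ p) r s = begin
    (scale a r +ₚ (0# ∷ (p *ₚ r))) *ₚ s
      ≈⟨ *ₚ-distribʳ s (scale a r) (0# ∷ (p *ₚ r)) ⟩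
    (scale a r *ₚ s) +ₚ ((0# ∷ (p *ₚ r)) *ₚ s)
      ≈⟨ +ₚ-cong (scale-*ₚ a r s) (shift-*ₚ (p *ₚ r)) ⟩
    scale a (r *ₚ s) +ₚ (0# ∷ ((p *ₚ r) *ₚ s))
      ≈⟨ +ₚ-cong (≋-refl {scale a (r *ₚ s)}) (∷-cong refl (*ₚ-assoc p r s)) ⟩
    scale a (r *ₚ s) +ₚ (0# ∷ (p *ₚ (r *ₚ s))) ∎
    where
    open ≋-Reasoning
    shift-*ₚ : ∀ t → ((0# ∷ t) *ₚ s) ≋ (0# ∷ (t *ₚ s))
    shift-*ₚ t = mk≋ λ
      { zero → trans (coeff-∷-*-zero 0# t s) (zeroˡ _)
      ; (suc n) → trans (coeff-∷-*-suc 0# t s n) (trans (+-congʳ (zeroˡ _)) (+-identityˡ _)) }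

  *ₚ-identityˡ : ∀ p → (1ₚ *ₚ p) ≋ p
  *ₚ-identityˡ p = mk≋ λ n → trans (coeff-+ (scale 1# p) (0# ∷ []) n)
    (trans (+-cong (coeff-scale 1# p n) (coeff-0∷[] n)) (trans (+-identityʳ _) (*-identityˡ _)))
    where
    coeff-0∷[] : ∀ n → coeff (0# ∷ []) n ≈ 0#
    coeff-0∷[] zero = refl
    coeff-0∷[] (suc n) = refl

  polyRing : CommutativeRing 0ℓ 0ℓ
  polyRing = record
    { Carrier = Poly ; _≈_ = _≋_ ; _+_ = _+ₚ_ ; _*_ = _*ₚ_ ; -_ = -ₚ_ ; 0# = 0ₚ ; 1# = 1ₚ
    ; isCommutativeRing = record
      { isRing = record
        { +-isAbelianGroup = record
          { isGroup = record
            { isMonoid = record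
              { isSemigroup = record
                { isMagma = record { isEquivalence = Setoid.isEquivalence ≋-setoid ; ∙-cong = +ₚ-cong }
                ; assoc = +ₚ-assoc }
              ; identity = (λ _ → ≋-refl) , +ₚ-identityʳ }
            ; inverse = -ₚ-inverseˡ , -ₚ-inverseʳ
            ; ⁻¹-cong = -ₚ-cong }
          ; comm = +ₚ-comm }
        ; *-cong = *ₚ-cong
        ; *-assoc = *ₚ-assoc
        ; *-identity = *ₚ-identityˡ , λ p → ≋-trans (*ₚ-comm p 1ₚ) (*ₚ-identityˡ p)
        ; distrib = (λ p r s → ≋-trans (*ₚ-comm p (r +ₚ s)) (≋-trans (*ₚ-distribʳ p r s)
                                          (+ₚ-cong (*ₚ-comm r p) (*ₚ-comm s p))))
                  , *ₚ-distribʳ }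
      ; *-comm = *ₚ-comm } }

module PolynomialOverField (F : CommutativeRing 0ℓ 0ℓ) (field-F : IsFieldCR F)
  (_≟_ : Decidable (CommutativeRing._≈_ F)) where

  open import Data.Nat as ℕ using (zero; suc; _≤_; z≤n; s≤s)
  import Data.Nat.Properties as ℕ
  open import Data.List using ([]; _∷_)
  open import Data.Product using (Σ; _,_; proj₁; proj₂)
  open import Data.Sum using (_⊎_; inj₁; inj₂; [_,_]′)
  open import Data.Empty using (⊥-elim)
  open import Relation.Nullary using (¬_; yes; no)
  open import Relation.Binary.Definitions using (tri<; tri≈; tri>)
  open import Relation.Binary.PropositionalEquality as ≡ using (_≡_)
  import Relation.Binary.Reasoning.Setoid as SetoidReasoning

  open CommutativeRing F renaming (Carrier to A) hiding (zero)
  open IsFieldCR field-F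
  open Over F
  open Polynomial F
  open import Algebra.Properties.Ring ring using (-0#≈0#)
  open CommutativeRingSolver polyRing using (solve; _:=_; _:+_; _:*_; _:-_)

  private
    module ≈-Reasoning = SetoidReasoning setoid
    module ≋-Reasoning = SetoidReasoning ≋-setoid

  *-nonzero : ∀ {a b} → ¬ a ≈ 0# → ¬ b ≈ 0# → ¬ (a * b) ≈ 0#
  *-nonzero {a} {b} a≉0 b≉0 ab≈0 = b≉0 (begin
    b                   ≈⟨ *-identityˡ b ⟨
    1# * b              ≈⟨ *-congʳ (trans (*-comm a⁻¹ a) a*a⁻¹≈1) ⟨
    (a⁻¹ * a) * b       ≈⟨ *-assoc _ _ _ ⟩
    a⁻¹ * (a * b)       ≈⟨ *-congˡ ab≈0 ⟩
    a⁻¹ * 0#            ≈⟨ zeroʳ _ ⟩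
    0#                  ∎)
    where
    open ≈-Reasoning
    a⁻¹ : A
    a⁻¹ = proj₁ (inverse a a≉0)
    a*a⁻¹≈1 : a * a⁻¹ ≈ 1#
    a*a⁻¹≈1 = proj₂ (inverse a a≉0)

  DegreeBelow : Poly → ℕ → Set
  DegreeBelow p n = ∀ m → n ≤ m → coeff p m ≈ 0#

  DegreeBelow-mono : ∀ {p n n'} → n ≤ n' → DegreeBelow p n → DegreeBelow p n'
  DegreeBelow-mono n≤n' lt m n'≤m = lt m (ℕ.≤-trans n≤n' n'≤m)

  DegreeBelow-zero : ∀ {p} → DegreeBelow p 0 → p ≋ 0ₚ
  DegreeBelow-zero lt = mk≋ λ m → lt m z≤n

  DegreeBelow-scale : ∀ a {p n} → DegreeBelow p n → DegreeBelow (scale a p) n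
  DegreeBelow-scale a {p} lt m n≤m = trans (coeff-scale a p m) (trans (*-congˡ (lt m n≤m)) (zeroʳ a))

  HasDegree⇒DegreeBelow : ∀ {p n} → HasDegree p n → DegreeBelow p (suc n)
  HasDegree⇒DegreeBelow (_ , above) = above

  HasDegree-resp : ∀ {p r n} → p ≋ r → HasDegree p n → HasDegree r n
  HasDegree-resp p≋r (top , above) =
    (λ z → top (trans (coeff-≈ p≋r _) z)) , λ m lt → trans (sym (coeff-≈ p≋r m)) (above m lt)

  HasDegree⇒≉0 : ∀ {p n} → HasDegree p n → ¬ p ≋ 0ₚ
  HasDegree⇒≉0 {n = n} (top , _) p≋0 = top (coeff-≈ p≋0 n)

  HasDegree-functional : ∀ {n m} p → HasDegree p n → HasDegree p m → n ≡ m
  HasDegree-functional {n} {m} p (top , above) (top' , above') with ℕ.<-cmp n m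
  ... | tri< n<m _ _ = ⊥-elim (top' (above m n<m))
  ... | tri≈ _ n≡m _ = n≡m
  ... | tri> _ _ m<n = ⊥-elim (top (above' n m<n))

  HasDegree-∷ : ∀ {c p k} → HasDegree p k → HasDegree (c ∷ p) (suc k)
  HasDegree-∷ (top , above) = top , λ { zero () ; (suc m) (s≤s lt) → above m lt }

  HasDegree-∷⁻ : ∀ {c p k} → HasDegree (c ∷ p) (suc k) → HasDegree p k
  HasDegree-∷⁻ (top , above) = top , λ m lt → above (suc m) (s≤s lt)

  HasDegree-const : ∀ {c} → ¬ c ≈ 0# → HasDegree (c ∷ []) 0
  HasDegree-const c≉0 = c≉0 , λ { zero () ; (suc m) _ → refl }

  HasDegree-zero⇒const : ∀ {c p} → HasDegree (c ∷ p) 0 → p ≋ 0ₚ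
  HasDegree-zero⇒const (_ , above) = mk≋ λ m → above (suc m) (s≤s z≤n)

  HasDegree-scale : ∀ {a p n} → ¬ a ≈ 0# → HasDegree p n → HasDegree (scale a p) n
  HasDegree-scale {a} {p} {n} a≉0 (top , above) =
    (λ z → *-nonzero a≉0 top (trans (sym (coeff-scale a p n)) z)) , DegreeBelow-scale a {p} above

  ∷-≋0 : ∀ {c p} → c ≈ 0# → p ≋ 0ₚ → (c ∷ p) ≋ 0ₚ
  ∷-≋0 c≈0 p≋0 = mk≋ λ { zero → c≈0 ; (suc m) → coeff-≈ p≋0 m }

  zero-or-degree : (p : Poly) → (p ≋ 0ₚ) ⊎ Σ ℕ (HasDegree p)
  zero-or-degree [] = inj₁ ≋-refl
  zero-or-degree (a ∷ p) with zero-or-degree p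
  ... | inj₂ (n , deg-p) = inj₂ (suc n , HasDegree-∷ deg-p)
  ... | inj₁ p≋0 with a ≟ 0#
  ...   | yes a≈0 = inj₁ (∷-≋0 a≈0 p≋0)
  ...   | no a≉0 = inj₂ (0 , a≉0 , λ { zero () ; (suc m) _ → coeff-≈ p≋0 m })

  ≉0⇒degree : ∀ {p} → ¬ p ≈ₚ 0ₚ → Σ ℕ (HasDegree p)
  ≉0⇒degree {p} p≉0 with zero-or-degree p
  ... | inj₁ p≋0 = ⊥-elim (p≉0 (coeff-≈ p≋0))
  ... | inj₂ deg-p = deg-p

  DegreeBelow-suc : ∀ {p n} → DegreeBelow p (suc n) → DegreeBelow p n ⊎ HasDegree p n
  DegreeBelow-suc {p} {n} lt with coeff p n ≟ 0#
  ... | no top = inj₂ (top , lt)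
  ... | yes top≈0 = inj₁ λ m n≤m → [ lt m , (λ { ≡.refl → top≈0 }) ]′ (ℕ.m≤n⇒m<n∨m≡n n≤m)

  HasDegree-+ₚ : ∀ {p r n} → HasDegree p n → DegreeBelow r n → HasDegree (r +ₚ p) n
  HasDegree-+ₚ {p} {r} {n} (top , above) lt =
    (λ z → top (trans (sym (trans (+-congʳ (lt n ℕ.≤-refl)) (+-identityˡ _))) (trans (sym (coeff-+ r p n)) z))) ,
    λ m n<m → trans (coeff-+ r p m) (trans (+-cong (lt m (ℕ.<⇒≤ n<m)) (above m n<m)) (+-identityˡ _))

  const-*ₚ : ∀ a p r → p ≋ 0ₚ → ((a ∷ p) *ₚ r) ≋ scale a r
  const-*ₚ a p r p≋0 = begin
    scale a r +ₚ (0# ∷ (p *ₚ r))   ≈⟨ +ₚ-cong (≋-refl {scale a r}) (∷-≋0 refl p*r≋0) ⟩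
    scale a r +ₚ []                ≈⟨ +ₚ-identityʳ (scale a r) ⟩
    scale a r                      ∎
    where
    open ≋-Reasoning
    p*r≋0 : (p *ₚ r) ≋ 0ₚ
    p*r≋0 = ≋-trans (*ₚ-comm p r) (≋-trans (*ₚ-congʳ r p≋0) (*ₚ-zeroʳ r))

  HasDegree-*ₚ : ∀ {n m} p r → HasDegree p n → HasDegree r m → HasDegree (p *ₚ r) (n ℕ.+ m)
  HasDegree-*ₚ [] r (top , _) _ = ⊥-elim (top refl)
  HasDegree-*ₚ {zero} (a ∷ p) r deg-p deg-r =
    HasDegree-resp (≋-sym (const-*ₚ a p r (HasDegree-zero⇒const deg-p))) (HasDegree-scale {a} {r} (proj₁ deg-p) deg-r)
  HasDegree-*ₚ {suc n} {m} (a ∷ p) r deg-p deg-r =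
    HasDegree-+ₚ {0# ∷ (p *ₚ r)} {scale a r} (HasDegree-∷ (HasDegree-*ₚ p r (HasDegree-∷⁻ deg-p) deg-r))
                 (DegreeBelow-scale a {r} (DegreeBelow-mono {r} (s≤s (ℕ.m≤n+m m n)) (HasDegree⇒DegreeBelow {r} deg-r)))

  *ₚ≋0⇒≋0 : ∀ p r → (p *ₚ r) ≋ 0ₚ → ¬ r ≋ 0ₚ → p ≋ 0ₚ
  *ₚ≋0⇒≋0 p r pr≋0 r≉0 with zero-or-degree p | zero-or-degree r
  ... | inj₁ p≋0 | _ = p≋0
  ... | inj₂ _ | inj₁ r≋0 = ⊥-elim (r≉0 r≋0)
  ... | inj₂ (_ , deg-p) | inj₂ (_ , deg-r) = ⊥-elim (HasDegree⇒≉0 (HasDegree-*ₚ p r deg-p deg-r) pr≋0)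

  *ₚ-cancelʳ : ∀ p p' r → (p *ₚ r) ≋ (p' *ₚ r) → ¬ r ≋ 0ₚ → p ≋ p'
  *ₚ-cancelʳ p p' r pr≋p'r r≉0 = begin
    p                        ≈⟨ solve 2 (λ x y → x := (x :- y) :+ y) ≋-refl p p' ⟩
    (p -ₚ p') +ₚ p'          ≈⟨ +ₚ-cong (*ₚ≋0⇒≋0 (p -ₚ p') r [p-p']r≋0 r≉0) (≋-refl {p'}) ⟩
    p'                       ∎
    where
    open ≋-Reasoning
    [p-p']r≋0 : ((p -ₚ p') *ₚ r) ≋ 0ₚ
    [p-p']r≋0 = begin
      (p -ₚ p') *ₚ r               ≈⟨ solve 3 (λ x y z → (x :- y) :* z := x :* z :- y :* z) ≋-refl p p' r ⟩
      (p *ₚ r) -ₚ (p' *ₚ r)        ≈⟨ +ₚ-cong pr≋p'r (≋-refl { -ₚ (p' *ₚ r)}) ⟩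
      (p' *ₚ r) -ₚ (p' *ₚ r)       ≈⟨ -ₚ-inverseʳ (p' *ₚ r) ⟩
      0ₚ                           ∎

  record Division (b : Poly) (db : ℕ) (s : Poly) : Set where
    constructor division
    field
      quotient remainder : Poly
      s≋qb+r : s ≋ ((quotient *ₚ b) +ₚ remainder)
      remainder<db : DegreeBelow remainder db

  module _ (b : Poly) {db : ℕ} (deg-b : HasDegree b db) where
    private
      lc⁻¹ : A
      lc⁻¹ = proj₁ (inverse (coeff b db) (proj₁ deg-b))

      lc*lc⁻¹≈1 : coeff b db * lc⁻¹ ≈ 1#
      lc*lc⁻¹≈1 = proj₂ (inverse (coeff b db) (proj₁ deg-b))

    -- If s = m b + r then a ∷ s = (0# ∷ m) b + (a ∷ r), and a ∷ r has degree at most db: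
    -- subtracting one scalar multiple of b cancels its coefficient of degree db.
    divide : ∀ s → Division b db s
    divide [] = division [] [] ≋-refl λ _ _ → refl
    divide (a ∷ s) with divide s
    ... | division m r s≋mb+r r<db = division (c ∷ m) r' a∷s≋ r'<db
      where
      c : A
      c = coeff (a ∷ r) db * lc⁻¹

      r' : Poly
      r' = (a ∷ r) -ₚ scale c b

      a∷s≋ : (a ∷ s) ≋ (((c ∷ m) *ₚ b) +ₚ r')
      a∷s≋ = begin
        a ∷ s
          ≈⟨ mk≋ (λ { zero → sym (+-identityˡ a) ; (suc n) → coeff-≈ s≋mb+r n }) ⟩
        (0# ∷ (m *ₚ b)) +ₚ (a ∷ r)
          ≈⟨ solve 3 (λ x y z → y :+ z := (x :+ y) :+ (z :- x)) ≋-refl (scale c b) (0# ∷ (m *ₚ b)) (a ∷ r) ⟩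
        (scale c b +ₚ (0# ∷ (m *ₚ b))) +ₚ r' ∎
        where open ≋-Reasoning

      coeff-r' : ∀ j → coeff r' j ≈ coeff (a ∷ r) j - c * coeff b j
      coeff-r' j = trans (coeff-+ (a ∷ r) (-ₚ scale c b) j)
                         (+-congˡ (trans (coeff-neg (scale c b) j) (-‿cong (coeff-scale c b j))))

      c*lc≈ : c * coeff b db ≈ coeff (a ∷ r) db
      c*lc≈ = trans (*-assoc _ _ _) (trans (*-congˡ (trans (*-comm _ _) lc*lc⁻¹≈1)) (*-identityʳ _))

      r'<db : DegreeBelow r' db
      r'<db j db≤j with ℕ.m≤n⇒m<n∨m≡n db≤j
      ... | inj₂ ≡.refl = trans (coeff-r' db) (trans (+-congˡ (-‿cong c*lc≈)) (-‿inverseʳ _))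
      ... | inj₁ (s≤s db≤j-1) = trans (coeff-r' _)
            (trans (+-cong (r<db _ db≤j-1) (-‿cong (trans (*-congˡ (proj₂ deg-b _ (s≤s db≤j-1))) (zeroʳ _))))
                   (trans (+-identityˡ _) -0#≈0#))

  degree-zero⇒∣1 : ∀ {c} → HasDegree c 0 → c ∣ₚ 1ₚ
  degree-zero⇒∣1 {[]} (top , _) = ⊥-elim (top refl)
  degree-zero⇒∣1 {c₀ ∷ c} deg-c = (c₀⁻¹ ∷ []) , coeff-≈ (begin
    1ₚ                       ≈⟨ ∷-cong (sym (proj₂ (inverse c₀ (proj₁ deg-c)))) ≋-refl ⟩
    scale c₀ (c₀⁻¹ ∷ [])     ≈⟨ const-*ₚ c₀ c (c₀⁻¹ ∷ []) (HasDegree-zero⇒const deg-c) ⟨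
    (c₀ ∷ c) *ₚ (c₀⁻¹ ∷ [])  ∎)
    where
    open ≋-Reasoning
    c₀⁻¹ : A
    c₀⁻¹ = proj₁ (inverse c₀ (proj₁ deg-c))

  ∣1⇒degree-zero : ∀ {c} → c ∣ₚ 1ₚ → HasDegree c 0
  ∣1⇒degree-zero {c} (e , 1≈ce) with zero-or-degree c | zero-or-degree e
  ... | inj₁ c≋0 | _ = ⊥-elim (1≉0 (trans (1≈ce 0) (coeff-≈ (*ₚ-congˡ e c≋0) 0)))
  ... | inj₂ _ | inj₁ e≋0 = ⊥-elim (1≉0 (trans (1≈ce 0) (coeff-≈ (≋-trans (*ₚ-congʳ c e≋0) (*ₚ-zeroʳ c)) 0)))
  ... | inj₂ (n , deg-c) | inj₂ (m , deg-e) with ℕ.m+n≡0⇒m≡0 n (≡.sym n+m≡0)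
    where
    n+m≡0 : 0 ≡ n ℕ.+ m
    n+m≡0 = HasDegree-functional 1ₚ (HasDegree-const 1≉0)
              (HasDegree-resp (≋-sym (mk≋ {1ₚ} {c *ₚ e} 1≈ce)) (HasDegree-*ₚ c e deg-c deg-e))
  ... | ≡.refl = deg-c

  HasDegree-+*ₚ : ∀ {r b t db k} → DegreeBelow r db → HasDegree b db → HasDegree t k →
                  HasDegree (r +ₚ (t *ₚ b)) (k ℕ.+ db)
  HasDegree-+*ₚ {r} {b} {t} {db} {k} r<db deg-b deg-t =
    HasDegree-+ₚ {t *ₚ b} {r} (HasDegree-*ₚ t b deg-t deg-b) (DegreeBelow-mono {r} (ℕ.m≤n+m db k) r<db)

  HasDegree-+*ₚ⁻ : ∀ {r b t db k} → DegreeBelow r db → HasDegree b db →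
                   HasDegree (r +ₚ (t *ₚ b)) (k ℕ.+ db) → HasDegree t k
  HasDegree-+*ₚ⁻ {r} {b} {t} {db} {k} r<db deg-b deg with zero-or-degree t
  ... | inj₁ t≋0 = ⊥-elim (proj₁ deg (trans (coeff-+ r (t *ₚ b) (k ℕ.+ db))
          (trans (+-cong (r<db _ (ℕ.m≤n+m db k)) (coeff-≈ (*ₚ-congˡ b t≋0) (k ℕ.+ db)))
                 (+-identityˡ 0#))))
  ... | inj₂ (j , deg-t) = ≡.subst (HasDegree t)
          (ℕ.+-cancelʳ-≡ db j k (HasDegree-functional (r +ₚ (t *ₚ b)) (HasDegree-+*ₚ {r} {b} {t} r<db deg-b deg-t) deg)) deg-t

module CoprimeDivisor (F : CommutativeRing 0ℓ 0ℓ) (field-F : IsFieldCR F)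
  (_≟_ : Decidable (CommutativeRing._≈_ F)) where

  open import Data.Nat as ℕ using (zero; suc; _≤_)
  import Data.Nat.Properties as ℕ
  open import Data.Fin using (Fin)
  open import Data.Product using (Σ; _,_; proj₁; proj₂)
  open import Data.Sum using (inj₁; inj₂)
  open import Data.Empty using (⊥-elim)
  import Relation.Binary.PropositionalEquality as ≡
  import Relation.Binary.Reasoning.Setoid as SetoidReasoning

  open CommutativeRing F renaming (Carrier to A) hiding (zero)
  open Over F
  open Polynomial F
  open PolynomialOverField F field-F _≟_
  open CommutativeRingSolver polyRing using (solve; _:=_; _:+_; _:*_; _:-_)

  private
    module ≋-Reasoning = SetoidReasoning ≋-setoid

  module _ {d : ℕ} (a : Fin d → Poly) (b : Poly) {db : ℕ} (deg-b : HasDegree b db)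
           (coprime : CoprimeTuple (a , b)) where

    InIdeal : Poly → Set
    InIdeal s = ∀ i → Σ Poly λ f → (s *ₚ a i) ≋ (b *ₚ f)

    private
      InIdeal-resp : ∀ {x y} → x ≋ y → InIdeal x → InIdeal y
      InIdeal-resp x≋y x∈I i = proj₁ (x∈I i) , ≋-trans (*ₚ-congˡ (a i) (≋-sym x≋y)) (proj₂ (x∈I i))

      b∈I : InIdeal b
      b∈I i = a i , ≋-refl

      x-zy∈I : ∀ {x y} → InIdeal x → InIdeal y → ∀ z → InIdeal (x -ₚ (z *ₚ y))
      x-zy∈I {x} {y} x∈I y∈I z i = (f -ₚ (z *ₚ g)) , (begin
        (x -ₚ (z *ₚ y)) *ₚ a i
          ≈⟨ solve 4 (λ X Y Z Ai → (X :- Z :* Y) :* Ai := X :* Ai :- Z :* (Y :* Ai)) ≋-refl x y z (a i) ⟩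
        (x *ₚ a i) -ₚ (z *ₚ (y *ₚ a i))
          ≈⟨ +ₚ-cong (proj₂ (x∈I i)) (-ₚ-cong (*ₚ-congʳ z (proj₂ (y∈I i)))) ⟩
        (b *ₚ f) -ₚ (z *ₚ (b *ₚ g))
          ≈⟨ solve 4 (λ B Fp Z G → B :* Fp :- Z :* (B :* G) := B :* (Fp :- Z :* G)) ≋-refl b f z g ⟩
        b *ₚ (f -ₚ (z *ₚ g)) ∎)
        where
        open ≋-Reasoning
        f g : Poly
        f = proj₁ (x∈I i)
        g = proj₁ (y∈I i)

      remainder∈I : ∀ {x y dy} → InIdeal x → InIdeal y → (D : Division y dy x) → InIdeal (Division.remainder D)
      remainder∈I {x} {y} x∈I y∈I (division m r x≋my+r _) = InIdeal-resp x-my≋r (x-zy∈I {x} {y} x∈I y∈I m)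
        where
        x-my≋r : (x -ₚ (m *ₚ y)) ≋ r
        x-my≋r = ≋-trans (+ₚ-cong x≋my+r (≋-refl { -ₚ (m *ₚ y)}))
                         (solve 2 (λ X Y → (X :+ Y) :- X := Y) ≋-refl (m *ₚ y) r)

    -- If r ∈ I had degree n < deg b, the remainder of b modulo r would lie in I with smaller
    -- degree, hence vanish by induction; then b = e r, and e, dividing every aᵢ too, is a unit.
    InIdeal-degreeBelow⇒≋0 : ∀ n r → DegreeBelow r n → n ≤ db → InIdeal r → r ≋ 0ₚ
    InIdeal-degreeBelow⇒≋0 zero r r<0 _ _ = DegreeBelow-zero r<0
    InIdeal-degreeBelow⇒≋0 (suc n) r r<n+1 n<db r∈I with DegreeBelow-suc {r} r<n+1
    ... | inj₁ r<n = InIdeal-degreeBelow⇒≋0 n r r<n (ℕ.≤-trans (ℕ.n≤1+n n) n<db) r∈I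
    ... | inj₂ deg-r = ⊥-elim (ℕ.<⇒≢ n<db (≡.sym (HasDegree-functional b deg-b deg-b=n)))
      where
      open Division (divide r deg-r b) renaming (quotient to e; remainder to r₂; s≋qb+r to b≋er+r₂)
      r₂≋0 : r₂ ≋ 0ₚ
      r₂≋0 = InIdeal-degreeBelow⇒≋0 n r₂ remainder<db (ℕ.≤-trans (ℕ.n≤1+n n) n<db)
               (remainder∈I b∈I r∈I (divide r deg-r b))
      b≋er : b ≋ (e *ₚ r)
      b≋er = ≋-trans b≋er+r₂ (≋-trans (+ₚ-cong (≋-refl {e *ₚ r}) r₂≋0) (+ₚ-identityʳ _))
      e∣a : ∀ i → a i ≋ (e *ₚ proj₁ (r∈I i))
      e∣a i = *ₚ-cancelʳ (a i) (e *ₚ f) r (begin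
        a i *ₚ r          ≈⟨ *ₚ-comm (a i) r ⟩
        r *ₚ a i          ≈⟨ proj₂ (r∈I i) ⟩
        b *ₚ f            ≈⟨ *ₚ-congˡ f b≋er ⟩
        (e *ₚ r) *ₚ f     ≈⟨ solve 3 (λ E R G → (E :* R) :* G := (E :* G) :* R) ≋-refl e r f ⟩
        (e *ₚ f) *ₚ r     ∎) (HasDegree⇒≉0 deg-r)
        where
        open ≋-Reasoning
        f : Poly
        f = proj₁ (r∈I i)
      e∣1 : e ∣ₚ 1ₚ
      e∣1 = coprime e (λ i → proj₁ (r∈I i) , coeff-≈ (e∣a i)) (r , coeff-≈ b≋er)
      deg-b=n : HasDegree b n
      deg-b=n = HasDegree-resp (≋-sym b≋er) (HasDegree-*ₚ e r (∣1⇒degree-zero {e} e∣1) deg-r)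

    coprime-divisor : ∀ s → InIdeal s → b ∣ₚ s
    coprime-divisor s s∈I = t , coeff-≈ (begin
      s                 ≈⟨ s≋tb+r ⟩
      (t *ₚ b) +ₚ r     ≈⟨ +ₚ-cong (*ₚ-comm t b) r≋0 ⟩
      (b *ₚ t) +ₚ 0ₚ    ≈⟨ +ₚ-identityʳ _ ⟩
      b *ₚ t            ∎)
      where
      open ≋-Reasoning
      open Division (divide b deg-b s) renaming (quotient to t; remainder to r; s≋qb+r to s≋tb+r)
      r≋0 : r ≋ 0ₚ
      r≋0 = InIdeal-degreeBelow⇒≋0 db r remainder<db ℕ.≤-refl (remainder∈I s∈I b∈I (divide b deg-b s))

module Counting where

  open import Data.Nat as ℕ using (suc; _≤_; _∸_; z≤n; s≤s)
  open import Data.List using (List; []; _∷_; length; map; cartesianProductWith)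
  import Data.List.Properties as List
  open import Data.List.Relation.Unary.All as All using (All; []; _∷_)
  import Data.List.Relation.Unary.All.Properties as All
  open import Data.List.Relation.Unary.Any as Any using (Any; here; there; _─_)
  import Data.List.Relation.Unary.Any.Properties as Any
  open import Data.List.Relation.Unary.AllPairs using ([]; _∷_)
  import Data.List.Membership.Setoid as Membership
  import Data.List.Membership.Setoid.Properties as Membershipₚ
  import Data.List.Relation.Unary.Unique.Setoid as Unique
  import Data.List.Relation.Unary.Unique.Setoid.Properties as Uniqueₚ
  open import Data.Product using (Σ; _×_; _,_)
  open import Data.Unit using (⊤; tt)
  open import Data.Empty using (⊥-elim)
  open import Function using (_∘_)
  open import Relation.Nullary using (¬_; Dec; yes; no)
  open import Relation.Binary.Bundles using (Setoid)
  open import Relation.Binary.Core using (_Preserves₂_⟶_⟶_)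
  open import Relation.Binary.PropositionalEquality as ≡ using (_≡_)

  module _ (S : Setoid 0ℓ 0ℓ) where
    open Setoid S renaming (Carrier to A)
    open Membership S using (_∈_)
    open Unique S using (Unique)

    private
      ∈-─⁺ : ∀ {x y xs} (x∈xs : x ∈ xs) → y ∈ xs → ¬ y ≈ x → y ∈ (xs ─ x∈xs)
      ∈-─⁺ (here x≈z) (here y≈z) y≉x = ⊥-elim (y≉x (trans y≈z (sym x≈z)))
      ∈-─⁺ (here _) (there y∈xs) _ = y∈xs
      ∈-─⁺ (there _) (here y≈z) _ = here y≈z
      ∈-─⁺ (there x∈xs) (there y∈xs) y≉x = there (∈-─⁺ x∈xs y∈xs y≉x)

      Unique-─⁺ : ∀ {P : A → Set} {xs} → Unique xs → (p : Any P xs) → Unique (xs ─ p)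
      Unique-─⁺ (_ ∷ u) (here _) = u
      Unique-─⁺ (z≉ ∷ u) (there p) = All.─⁺ p z≉ ∷ Unique-─⁺ u p

      ∉-─ : ∀ {x xs} → Unique xs → (x∈xs : x ∈ xs) → All (λ y → ¬ y ≈ x) (xs ─ x∈xs)
      ∉-─ (z≉ ∷ _) (here x≈z) = All.map (λ z≉y y≈x → z≉y (sym (trans y≈x x≈z))) z≉
      ∉-─ (z≉ ∷ u) (there x∈xs) =
        (λ z≈x → Membershipₚ.All[≉]⇒∉ S z≉ (Membershipₚ.∈-resp-≈ S (sym z≈x) x∈xs)) ∷ ∉-─ u x∈xs

    unique-⊆⇒length≤ : ∀ {xs ys} → Unique xs → All (_∈ ys) xs → length xs ≤ length ys
    unique-⊆⇒length≤ [] [] = z≤n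
    unique-⊆⇒length≤ {x ∷ xs} {ys} (x≉ ∷ u) (x∈ys ∷ xs⊆ys) =
      ≡.subst (suc (length xs) ≤_) (≡.sym (List.length-removeAt′ ys (Any.index x∈ys)))
        (s≤s (unique-⊆⇒length≤ u (All.zipWith (λ (x≉y , y∈ys) → ∈-─⁺ x∈ys y∈ys (x≉y ∘ sym)) (x≉ , xs⊆ys))))

    covered⇒CardLE : ∀ {P : A → Set} ys → (∀ x → P x → x ∈ ys) → CardLE _≈_ P (length ys)
    covered⇒CardLE ys covers xs Pxs u = unique-⊆⇒length≤ u (All.map (covers _) Pxs)

    CardEq⇒CardLE : ∀ {P : A → Set} {n} → CardEq _≈_ P n → CardLE _≈_ P n
    CardEq⇒CardLE (ys , _ , _ , covers , ≡.refl) = covered⇒CardLE ys covers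

    CardEq-remove : ∀ {P : A → Set} {n x} → CardEq _≈_ P n → P x →
                    CardEq _≈_ (λ y → P y × ¬ y ≈ x) (n ∸ 1)
    CardEq-remove {x = x} (xs , Pxs , u , covers , ≡.refl) Px =
      (xs ─ x∈xs) , All.zip (All.─⁺ x∈xs Pxs , ∉-─ u x∈xs) , Unique-─⁺ u x∈xs ,
      (λ { y (Py , y≉x) → ∈-─⁺ x∈xs (covers y Py) y≉x }) , List.length-removeAt xs (Any.index x∈xs)
      where
      x∈xs : x ∈ xs
      x∈xs = covers x Px

    private
      ≈-dec-∈ : ∀ {x y xs} → Unique xs → x ∈ xs → y ∈ xs → Dec (x ≈ y)
      ≈-dec-∈ _ (here x≈z) (here y≈z) = yes (trans x≈z (sym y≈z))
      ≈-dec-∈ (z≉ ∷ _) (here x≈z) (there y∈xs) =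
        no λ x≈y → Membershipₚ.All[≉]⇒∉ S z≉ (Membershipₚ.∈-resp-≈ S (trans (sym x≈y) x≈z) y∈xs)
      ≈-dec-∈ (z≉ ∷ _) (there x∈xs) (here y≈z) =
        no λ x≈y → Membershipₚ.All[≉]⇒∉ S z≉ (Membershipₚ.∈-resp-≈ S (trans x≈y y≈z) x∈xs)
      ≈-dec-∈ (_ ∷ u) (there x∈xs) (there y∈xs) = ≈-dec-∈ u x∈xs y∈xs

    CardEq-⊤⇒decidable : ∀ {n} → CardEq _≈_ (λ _ → ⊤) n → Decidable _≈_
    CardEq-⊤⇒decidable (_ , _ , u , covers , _) x y = ≈-dec-∈ u (covers x tt) (covers y tt)

  module _ (S T : Setoid 0ℓ 0ℓ) where
    open Setoid S using () renaming (Carrier to A; _≈_ to _≈₁_)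
    open Setoid T using (sym) renaming (Carrier to B; _≈_ to _≈₂_)

    module _ (f : A → B) (f-cong : ∀ {x y} → x ≈₁ y → f x ≈₂ f y)
             {P : A → Set} {Q : B → Set} {n : ℕ}
             (preimage : ∀ y → Q y → Σ A λ x → P x × y ≈₂ f x) where

      private
        covers-map : ∀ {xs} → (∀ x → P x → Any (x ≈₁_) xs) → ∀ y → Q y → Any (y ≈₂_) (map f xs)
        covers-map covers y Qy with preimage y Qy
        ... | x , Px , y≈fx = Membershipₚ.∈-resp-≈ T (sym y≈fx) (Membershipₚ.∈-map⁺ S T f-cong (covers x Px))

      CardLE-image : CardEq _≈₁_ P n → CardLE _≈₂_ Q n
      CardLE-image (xs , _ , _ , covers , ≡.refl) =
        ≡.subst (CardLE _≈₂_ Q) (List.length-map f xs) (covered⇒CardLE T (map f xs) (covers-map covers))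

      CardEq-image : (∀ {x y} → f x ≈₂ f y → x ≈₁ y) → (∀ x → P x → Q (f x)) →
                     CardEq _≈₁_ P n → CardEq _≈₂_ Q n
      CardEq-image f-injective P⇒Qf (xs , Pxs , u , covers , ≡.refl) =
        map f xs , All.map⁺ (All.map (P⇒Qf _) Pxs) , Uniqueₚ.map⁺ S T f-injective u ,
        covers-map covers , List.length-map f xs

  length-cartesianProductWith : ∀ {A B C : Set} (f : A → B → C) xs ys →
    length (cartesianProductWith f xs ys) ≡ length xs ℕ.* length ys
  length-cartesianProductWith f [] ys = ≡.refl
  length-cartesianProductWith f (x ∷ xs) ys = ≡.trans (List.length-++ (map (f x) ys))
    (≡.cong₂ ℕ._+_ (List.length-map (f x) ys) (length-cartesianProductWith f xs ys))

  module _ (S T U : Setoid 0ℓ 0ℓ) where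
    open Setoid S using () renaming (Carrier to A; _≈_ to _≈₁_)
    open Setoid T using () renaming (Carrier to B; _≈_ to _≈₂_)
    open Setoid U using (sym) renaming (Carrier to C; _≈_ to _≈₃_)

    CardEq-productWith : ∀ {f : A → B → C} → f Preserves₂ _≈₁_ ⟶ _≈₂_ ⟶ _≈₃_ →
      (∀ {w x y z} → f w y ≈₃ f x z → w ≈₁ x × y ≈₂ z) →
      ∀ {P : A → Set} {Q : B → Set} {R : C → Set} {m n} → (∀ {x y} → P x → Q y → R (f x y)) →
      (∀ z → R z → Σ A λ x → Σ B λ y → P x × Q y × z ≈₃ f x y) →
      CardEq _≈₁_ P m → CardEq _≈₂_ Q n → CardEq _≈₃_ R (m ℕ.* n)
    CardEq-productWith {f} f-cong f-injective {R = R} PQ⇒R decompose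
      (xs , Pxs , uxs , covers-x , ≡.refl) (ys , Qys , uys , covers-y , ≡.refl) =
      cartesianProductWith f xs ys ,
      All.cartesianProductWith⁺ (≡.setoid A) (≡.setoid B) f xs ys
        (λ x∈xs y∈ys → PQ⇒R (All.lookup Pxs x∈xs) (All.lookup Qys y∈ys)) ,
      Uniqueₚ.cartesianProductWith⁺ S T U f f-injective uxs uys ,
      covers , length-cartesianProductWith f xs ys
      where
      covers : ∀ z → R z → Any (z ≈₃_) (cartesianProductWith f xs ys)
      covers z Rz with decompose z Rz
      ... | x , y , Px , Qy , z≈fxy = Membershipₚ.∈-resp-≈ U (sym z≈fxy)
        (Membershipₚ.∈-cartesianProductWith⁺ S T U f-cong (covers-x x Px) (covers-y y Qy))

module Lattice (F : CommutativeRing 0ℓ 0ℓ) (field-F : IsFieldCR F)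
  (_≟_ : Decidable (CommutativeRing._≈_ F)) where

  open import Data.Fin using (Fin)
  open import Data.Product using (Σ; _×_; _,_; proj₁; proj₂)
  open import Relation.Nullary using (¬_)
  open import Relation.Binary.Bundles using (Setoid)
  import Relation.Binary.Reasoning.Setoid as SetoidReasoning

  open CommutativeRing F renaming (Carrier to A) hiding (zero)
  open Over F
  open Polynomial F
  open PolynomialOverField F field-F _≟_
  open CoprimeDivisor F field-F _≟_
  open CommutativeRingSolver polyRing using (solve; _:=_; _:+_; _:*_; _:-_; :-_)

  private
    module ≋-Reasoning = SetoidReasoning ≋-setoid

  Rd-setoid : ℕ → Setoid 0ℓ 0ℓ
  Rd-setoid d = record
    { Carrier = Rd d ; _≈_ = _≈R_
    ; isEquivalence = record
      { refl = (λ _ _ → refl) , λ _ → refl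
      ; sym = λ (a≈ , b≈) → (λ i n → sym (a≈ i n)) , λ n → sym (b≈ n)
      ; trans = λ (a≈ , b≈) (a≈' , b≈') →
                  (λ i n → trans (a≈ i n) (a≈' i n)) , λ n → trans (b≈ n) (b≈' n) } }

  module _ {d : ℕ} where

    -- π_u(v)ᵢ = (b' aᵢ − a'ᵢ b) / b for u = (a , b), v = (a' , b').
    π-numerator : Rd d → Rd d → Fin d → Poly
    π-numerator (a , b) (a' , b') i = (b' *ₚ a i) -ₚ (a' i *ₚ b)

    infix 6 _⊕_·_
    _⊕_·_ : Rd d → Poly → Rd d → Rd d
    (a' , b') ⊕ t · (a , b) = (λ i → a' i +ₚ (t *ₚ a i)) , (b' +ₚ (t *ₚ b))

    π-numerator-⊕· : ∀ u v t i → π-numerator u (v ⊕ t · u) i ≋ π-numerator u v i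
    π-numerator-⊕· (a , b) (a' , b') t i =
      solve 5 (λ A' B' T Ai B → (B' :+ T :* B) :* Ai :- (A' :+ T :* Ai) :* B := B' :* Ai :- A' :* B)
        ≋-refl (a' i) b' t (a i) b

    ⊕·-cong : ∀ v u {t t'} → t ≋ t' → (v ⊕ t · u) ≈R (v ⊕ t' · u)
    ⊕·-cong (a' , b') (a , b) t≋t' =
      (λ i → coeff-≈ (+ₚ-cong (≋-refl {a' i}) (*ₚ-congˡ (a i) t≋t'))) ,
      coeff-≈ (+ₚ-cong (≋-refl {b'}) (*ₚ-congˡ b t≋t'))

    ⊕·-injective : ∀ v u {t t'} → ¬ proj₂ u ≋ 0ₚ → (v ⊕ t · u) ≈R (v ⊕ t' · u) → t ≋ t'
    ⊕·-injective (a' , b') (a , b) {t} {t'} b≉0 (_ , b'+tb≈b'+t'b) = *ₚ-cancelʳ t t' b (begin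
      t *ₚ b                            ≈⟨ solve 3 (λ B' T B → T :* B := (B' :+ T :* B) :- B') ≋-refl b' t b ⟩
      (b' +ₚ (t *ₚ b)) -ₚ b'            ≈⟨ +ₚ-cong (mk≋ b'+tb≈b'+t'b) (≋-refl { -ₚ b'}) ⟩
      (b' +ₚ (t' *ₚ b)) -ₚ b'           ≈⟨ solve 3 (λ B' T B → (B' :+ T :* B) :- B' := T :* B) ≋-refl b' t' b ⟩
      t' *ₚ b                           ∎) b≉0
      where open ≋-Reasoning

  module Preimages {d : ℕ} {a : Fin d → Poly} {b : Poly} (uQ : InQ (a , b)) (α : Kd d) where

    Preimage : Rd d → Set
    Preimage v = ∀ i → π (a , b) uQ v i ≈K α i

    Preimage⇒≋ : ∀ {v} → Preimage v → ∀ i → (π-numerator (a , b) v i *ₚ den (α i)) ≋ (num (α i) *ₚ b)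
    Preimage⇒≋ v∈ i = mk≋ (v∈ i)

    preimage-⊕· : ∀ {v} → Preimage v → ∀ t → Preimage (v ⊕ t · (a , b))
    preimage-⊕· {v} v∈ t i = coeff-≈ (≋-trans (*ₚ-congˡ (den (α i)) (π-numerator-⊕· (a , b) v t i)) (Preimage⇒≋ {v} v∈ i))

    difference-∈-kernel : ∀ {a' b' a'' b''} → Preimage (a' , b') → Preimage (a'' , b'') →
                          ∀ i → ((b'' -ₚ b') *ₚ a i) ≋ (b *ₚ (a'' i -ₚ a' i))
    difference-∈-kernel {a'} {b'} {a''} {b''} v∈ v'∈ i = begin
      (b'' -ₚ b') *ₚ a i
        ≈⟨ solve 6 (λ B'' B' Ai A'' A' B → (B'' :- B') :* Ai
                     := ((B'' :* Ai :- A'' :* B) :- (B' :* Ai :- A' :* B)) :+ B :* (A'' :- A'))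
                   ≋-refl b'' b' (a i) (a'' i) (a' i) b ⟩
      (π-numerator (a , b) (a'' , b'') i -ₚ π-numerator (a , b) (a' , b') i) +ₚ (b *ₚ (a'' i -ₚ a' i))
        ≈⟨ +ₚ-cong (≋-trans (+ₚ-cong same-numerator ≋-refl)
                            (-ₚ-inverseʳ (π-numerator (a , b) (a' , b') i))) ≋-refl ⟩
      b *ₚ (a'' i -ₚ a' i) ∎
      where
      open ≋-Reasoning
      same-numerator : π-numerator (a , b) (a'' , b'') i ≋ π-numerator (a , b) (a' , b') i
      same-numerator = *ₚ-cancelʳ _ _ (den (α i))
        (≋-trans (Preimage⇒≋ {a'' , b''} v'∈ i) (≋-sym (Preimage⇒≋ {a' , b'} v∈ i)))
        (λ den≋0 → den≉0 (α i) (coeff-≈ den≋0))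

    module _ {db : ℕ} (deg-b : HasDegree b db) where

      preimage-difference : ∀ {v v'} → Preimage v → Preimage v' → Σ Poly λ t → v' ≈R (v ⊕ t · (a , b))
      preimage-difference {a' , b'} {a'' , b''} v∈ v'∈ = t , (λ i → coeff-≈ (a''≋a'+ta i)) , coeff-≈ b''≋b'+tb
        where
        open ≋-Reasoning
        kernel : ∀ i → ((b'' -ₚ b') *ₚ a i) ≋ (b *ₚ (a'' i -ₚ a' i))
        kernel = difference-∈-kernel {a'} {b'} {a''} {b''} v∈ v'∈
        b∣b''-b' : b ∣ₚ (b'' -ₚ b')
        b∣b''-b' = coprime-divisor a b deg-b (proj₁ uQ) (b'' -ₚ b') (λ i → (a'' i -ₚ a' i) , kernel i)
        t : Poly
        t = proj₁ b∣b''-b'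
        b''-b'≋bt : (b'' -ₚ b') ≋ (b *ₚ t)
        b''-b'≋bt = mk≋ (proj₂ b∣b''-b')
        b''≋b'+tb : b'' ≋ (b' +ₚ (t *ₚ b))
        b''≋b'+tb = begin
          b''                     ≈⟨ solve 2 (λ X Y → X := Y :+ (X :- Y)) ≋-refl b'' b' ⟩
          b' +ₚ (b'' -ₚ b')       ≈⟨ +ₚ-cong (≋-refl {b'}) (≋-trans b''-b'≋bt (*ₚ-comm b t)) ⟩
          b' +ₚ (t *ₚ b)          ∎
        a''≋a'+ta : ∀ i → a'' i ≋ (a' i +ₚ (t *ₚ a i))
        a''≋a'+ta i = begin
          a'' i                   ≈⟨ solve 2 (λ X Y → X := Y :+ (X :- Y)) ≋-refl (a'' i) (a' i) ⟩
          a' i +ₚ (a'' i -ₚ a' i) ≈⟨ +ₚ-cong (≋-refl {a' i}) (*ₚ-cancelʳ _ _ b (begin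
            (a'' i -ₚ a' i) *ₚ b     ≈⟨ *ₚ-comm (a'' i -ₚ a' i) b ⟩
            b *ₚ (a'' i -ₚ a' i)     ≈⟨ kernel i ⟨
            (b'' -ₚ b') *ₚ a i       ≈⟨ *ₚ-congˡ (a i) b''-b'≋bt ⟩
            (b *ₚ t) *ₚ a i          ≈⟨ solve 3 (λ B T Ai → (B :* T) :* Ai := (T :* Ai) :* B) ≋-refl b t (a i) ⟩
            (t *ₚ a i) *ₚ b          ∎) (HasDegree⇒≉0 deg-b)) ⟩
          a' i +ₚ (t *ₚ a i)      ∎

      reduced-preimage : ∀ {w} → Preimage w → Σ (Rd d) λ w₀ → Preimage w₀ × DegreeBelow (proj₂ w₀) db
      reduced-preimage {a₀ , b₀} w∈ = (a₀ , b₀) ⊕ (-ₚ m) · (a , b) , preimage-⊕· {a₀ , b₀} w∈ (-ₚ m) , r<db'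
        where
        open Division (divide b deg-b b₀) renaming (quotient to m; remainder to r; s≋qb+r to b₀≋mb+r)
        b₀-mb≋r : (b₀ +ₚ ((-ₚ m) *ₚ b)) ≋ r
        b₀-mb≋r = ≋-trans (+ₚ-cong b₀≋mb+r (≋-refl {(-ₚ m) *ₚ b}))
                          (solve 3 (λ M B R → (M :* B :+ R) :+ (:- M) :* B := R) ≋-refl m b r)
        r<db' : DegreeBelow (b₀ +ₚ ((-ₚ m) *ₚ b)) db
        r<db' j db≤j = trans (coeff-≈ b₀-mb≋r j) (remainder<db j db≤j)

module OverFiniteField (F : CommutativeRing 0ℓ 0ℓ) (field-F : IsFieldCR F) (q : ℕ) (card-F : HasCard F q) where

  open import Data.Nat as ℕ using (zero; suc; _<_; _∸_; _^_; z≤n; s≤s)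
  import Data.Nat.Properties as ℕ
  open import Data.Fin using (Fin)
  open import Data.List using ([]; _∷_)
  open import Data.List.Relation.Unary.All using ([]; _∷_)
  open import Data.List.Relation.Unary.AllPairs using ([]; _∷_)
  open import Data.Product using (Σ; _×_; _,_; proj₁; proj₂)
  open import Data.Sum using (inj₁; inj₂)
  open import Data.Unit using (⊤; tt)
  open import Data.Empty using (⊥-elim)
  open import Relation.Nullary using (¬_)
  open import Relation.Binary.Definitions using (tri<; tri≈; tri>)
  open import Relation.Binary.PropositionalEquality as ≡ using (_≡_)
  import Relation.Binary.Reasoning.Setoid as SetoidReasoning
  open import Algebra.Properties.CommutativeSemigroup ℕ.*-commutativeSemigroup using (x∙yz≈y∙xz)

  open CommutativeRing F renaming (Carrier to A) hiding (zero)
  open IsFieldCR field-F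
  open Over F
  open Counting

  _≟_ : Decidable _≈_
  _≟_ = CardEq-⊤⇒decidable setoid card-F

  open Polynomial F
  open PolynomialOverField F field-F _≟_
  open Lattice F field-F _≟_
  open CommutativeRingSolver polyRing using (solve; _:=_; _:*_; _:-_)

  private
    module ≋-Reasoning = SetoidReasoning ≋-setoid

  1<q : 1 < q
  1<q = CardEq⇒CardLE setoid card-F (0# ∷ 1# ∷ []) (tt ∷ tt ∷ []) (((λ 0≈1 → 1≉0 (sym 0≈1)) ∷ []) ∷ [] ∷ [])

  ^-injective : ∀ {m n} → q ^ m ≡ q ^ n → m ≡ n
  ^-injective {m} {n} q^m≡q^n with ℕ.<-cmp m n
  ... | tri< m<n _ _ = ⊥-elim (ℕ.<⇒≢ (ℕ.^-monoʳ-< q 1<q m<n) q^m≡q^n)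
  ... | tri≈ _ m≡n _ = m≡n
  ... | tri> _ _ n<m = ⊥-elim (ℕ.<⇒≢ (ℕ.^-monoʳ-< q 1<q n<m) (≡.sym q^m≡q^n))

  Norm-degree : ∀ {p n r} → HasDegree p n → Norm q p r → r ≡ q ^ n
  Norm-degree {p} deg-p (inj₁ (p≈0 , _)) = ⊥-elim (HasDegree⇒≉0 {p} deg-p (mk≋ p≈0))
  Norm-degree {p} deg-p (inj₂ (m , deg-p' , r≡q^m)) = ≡.trans r≡q^m (≡.cong (q ^_) (HasDegree-functional p deg-p' deg-p))

  Norm⇒degree : ∀ {p n} → ¬ p ≈ₚ 0ₚ → Norm q p (q ^ n) → HasDegree p n
  Norm⇒degree p≉0 (inj₁ (p≈0 , _)) = ⊥-elim (p≉0 p≈0)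
  Norm⇒degree {p} p≉0 (inj₂ (m , deg-p , q^n≡q^m)) = ≡.subst (HasDegree p) (^-injective (≡.sym q^n≡q^m)) deg-p

  nonzero-card : CardEq _≈_ (λ c → ⊤ × ¬ c ≈ 0#) (q ∸ 1)
  nonzero-card = CardEq-remove setoid card-F tt

  degree-card : ∀ k → CardEq _≋_ (λ p → HasDegree p k) ((q ∸ 1) ℕ.* q ^ k)
  degree-card zero = ≡.subst (CardEq _≋_ (λ p → HasDegree p 0)) (≡.sym (ℕ.*-identityʳ (q ∸ 1)))
    (CardEq-image setoid ≋-setoid (_∷ []) (λ c≈c' → ∷-cong c≈c' ≋-refl) constant
      (λ c∷[]≋c'∷[] → coeff-≈ c∷[]≋c'∷[] 0) (λ _ (_ , c≉0) → HasDegree-const c≉0) nonzero-card)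
    where
    constant : ∀ p → HasDegree p 0 → Σ A λ c → (⊤ × ¬ c ≈ 0#) × p ≋ (c ∷ [])
    constant [] (top , _) = ⊥-elim (top refl)
    constant (c ∷ p) deg-p = c , (tt , proj₁ deg-p) , ∷-cong refl (HasDegree-zero⇒const deg-p)
  degree-card (suc k) = ≡.subst (CardEq _≋_ (λ p → HasDegree p (suc k))) (x∙yz≈y∙xz q (q ∸ 1) (q ^ k))
    (CardEq-productWith setoid ≋-setoid ≋-setoid ∷-cong
      (λ c∷p≋c'∷p' → coeff-≈ c∷p≋c'∷p' 0 , mk≋ λ n → coeff-≈ c∷p≋c'∷p' (suc n))
      (λ _ → HasDegree-∷) leading card-F (degree-card k))
    where
    leading : ∀ p → HasDegree p (suc k) → Σ A λ c → Σ Poly λ p' → ⊤ × HasDegree p' k × p ≋ (c ∷ p')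
    leading [] (top , _) = ⊥-elim (top refl)
    leading (c ∷ p) deg-p = c , p , tt , HasDegree-∷⁻ deg-p , ≋-refl

  module _ {d : ℕ} {a : Fin d → Poly} {b : Poly} (uQ : InQ (a , b)) (α : Kd d) where
    open Preimages {a = a} {b = b} uQ α

    primitive-preimage-coprime : Primitive q (a , b) uQ α → ∀ {v} → Preimage v → ¬ proj₂ v ≈ₚ 0ₚ → CoprimeTuple v
    primitive-preimage-coprime prim {a' , b'} v∈ b'≉0 c c∣a' c∣b' with zero-or-degree c
    ... | inj₁ c≋0 = ⊥-elim (b'≉0 (λ n → trans (proj₂ c∣b' n) (coeff-≈ (*ₚ-congˡ (proj₁ c∣b') c≋0) n)))
    ... | inj₂ (zero , deg-c) = degree-zero⇒∣1 {c} deg-c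
    ... | inj₂ (suc n , deg-c) =
      ⊥-elim (proj₂ prim (β , (e , λ _ _ → refl) , c , (q ^ suc n , inj₂ (suc n , deg-c , ≡.refl) , 1<q^1+n) , α≈c·β))
      where
      open ≋-Reasoning
      e : Rd d
      e = (λ i → proj₁ (c∣a' i)) , proj₁ c∣b'
      β : Kd d
      β = π (a , b) uQ e
      1<q^1+n : 1 < q ^ suc n
      1<q^1+n = ℕ.^-monoʳ-< q 1<q {0} {suc n} (s≤s z≤n)
      α≈c·β : ∀ i → α i ≈K (c • β i)
      α≈c·β i = coeff-≈ (begin
        num (α i) *ₚ b
          ≈⟨ Preimage⇒≋ {a' , b'} v∈ i ⟨
        π-numerator (a , b) (a' , b') i *ₚ den (α i)
          ≈⟨ *ₚ-congˡ (den (α i)) (+ₚ-cong (*ₚ-congˡ (a i) (mk≋ {b'} {c *ₚ proj₂ e} (proj₂ c∣b')))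
                                           (-ₚ-cong (*ₚ-congˡ b (mk≋ {a' i} {c *ₚ proj₁ e i} (proj₂ (c∣a' i)))))) ⟩
        π-numerator (a , b) ((λ i → c *ₚ proj₁ e i) , c *ₚ proj₂ e) i *ₚ den (α i)
          ≈⟨ *ₚ-congˡ (den (α i)) (solve 5 (λ C Eb Ea Ai B → (C :* Eb) :* Ai :- (C :* Ea) :* B := C :* (Eb :* Ai :- Ea :* B))
                                           ≋-refl c (proj₂ e) (proj₁ e i) (a i) b) ⟩
        (c *ₚ π-numerator (a , b) e i) *ₚ den (α i) ∎)

    module _ {db : ℕ} (deg-b : HasDegree b db) (w₀ : Rd d) (w₀∈ : Preimage w₀)
             (b₀<db : DegreeBelow (proj₂ w₀) db) (k : ℕ) where

      fiber⇒⊕· : ∀ v → Fiber q (a , b) uQ α k v → Σ Poly λ t → HasDegree t k × v ≈R (w₀ ⊕ t · (a , b))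
      fiber⇒⊕· v ((_ , b'≉0) , v∈ , r , norm-b , norm-b') =
        t , HasDegree-+*ₚ⁻ {proj₂ w₀} {b} {t} b₀<db deg-b deg-w₀+tu , v≈w₀+tu
        where
        difference : Σ Poly λ t → v ≈R (w₀ ⊕ t · (a , b))
        difference = preimage-difference deg-b {w₀} {v} w₀∈ v∈
        t : Poly
        t = proj₁ difference
        v≈w₀+tu : v ≈R (w₀ ⊕ t · (a , b))
        v≈w₀+tu = proj₂ difference
        deg-b' : HasDegree (proj₂ v) (k ℕ.+ db)
        deg-b' = Norm⇒degree {proj₂ v} b'≉0 (≡.subst (Norm q (proj₂ v))
          (≡.trans (≡.cong (q ^ k ℕ.*_) (Norm-degree {b} deg-b norm-b)) (≡.sym (ℕ.^-distribˡ-+-* q k db))) norm-b')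
        deg-w₀+tu : HasDegree (proj₂ w₀ +ₚ (t *ₚ b)) (k ℕ.+ db)
        deg-w₀+tu = HasDegree-resp (mk≋ {proj₂ v} {proj₂ w₀ +ₚ (t *ₚ b)} (proj₂ v≈w₀+tu)) deg-b'

      ⊕·∈fiber : Primitive q (a , b) uQ α → ∀ t → HasDegree t k → Fiber q (a , b) uQ α k (w₀ ⊕ t · (a , b))
      ⊕·∈fiber prim t deg-t =
        (primitive-preimage-coprime prim {w₀ ⊕ t · (a , b)} (preimage-⊕· {w₀} w₀∈ t) b'≉0 , b'≉0) ,
        preimage-⊕· {w₀} w₀∈ t ,
        q ^ db , inj₂ (db , deg-b , ≡.refl) , inj₂ (k ℕ.+ db , deg-b' , ≡.sym (ℕ.^-distribˡ-+-* q k db))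
        where
        deg-b' : HasDegree (proj₂ w₀ +ₚ (t *ₚ b)) (k ℕ.+ db)
        deg-b' = HasDegree-+*ₚ {proj₂ w₀} {b} {t} b₀<db deg-b deg-t
        b'≉0 : ¬ (proj₂ w₀ +ₚ (t *ₚ b)) ≈ₚ 0ₚ
        b'≉0 b'≈0 = HasDegree⇒≉0 {proj₂ w₀ +ₚ (t *ₚ b)} deg-b' (mk≋ b'≈0)

open import Data.Nat using (_∸_; _*_; _^_)
open import Data.Product using (Σ; _×_; _,_; proj₁; proj₂)
open Counting

lemma4p13 : (q : ℕ) (F : CommutativeRing 0ℓ 0ℓ) → IsFieldCR F → HasCard F q →
    (d : ℕ) (u : Over.Rd F d) (uQ : Over.InQ F u) (α : Over.Kd F d) →
    Over.InΛ F u uQ α → (k : ℕ) →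
    CardLE (Over._≈R_ F) (Over.Fiber F q u uQ α k) ((q ∸ 1) * q ^ k)
    × (Over.Primitive F q u uQ α →
         CardEq (Over._≈R_ F) (Over.Fiber F q u uQ α k) ((q ∸ 1) * q ^ k))
lemma4p13 q F field-F card-F d (a , b) uQ α (w , w∈Λ) k =
  CardLE-image ≋-setoid (Rd-setoid d) translate (⊕·-cong w₀ (a , b)) fiber⊆translates (degree-card k) ,
  λ prim → CardEq-image ≋-setoid (Rd-setoid d) translate (⊕·-cong w₀ (a , b)) fiber⊆translates
             (⊕·-injective w₀ (a , b) (HasDegree⇒≉0 {b} deg-b))
             (⊕·∈fiber uQ α deg-b w₀ w₀∈ b₀<db k prim) (degree-card k)
  where
  open Over F
  open OverFiniteField F field-F q card-F
  open PolynomialOverField F field-F _≟_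
  open Lattice F field-F _≟_
  open Preimages {a = a} {b = b} uQ α
  open Polynomial F using (≋-setoid)
  db : ℕ
  db = proj₁ (≉0⇒degree {b} (proj₂ uQ))
  deg-b : HasDegree b db
  deg-b = proj₂ (≉0⇒degree {b} (proj₂ uQ))
  reduced : Σ (Rd d) λ w₀ → Preimage w₀ × DegreeBelow (proj₂ w₀) db
  reduced = reduced-preimage deg-b {w} w∈Λ
  w₀ : Rd d
  w₀ = proj₁ reduced
  w₀∈ : Preimage w₀
  w₀∈ = proj₁ (proj₂ reduced)
  b₀<db : DegreeBelow (proj₂ w₀) db
  b₀<db = proj₂ (proj₂ reduced)
  translate : Poly → Rd d
  translate t = w₀ ⊕ t · (a , b)
  fiber⊆translates : ∀ v → Fiber q (a , b) uQ α k v → Σ Poly λ t → HasDegree t k × v ≈R translate t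
  fiber⊆translates = fiber⇒⊕· uQ α deg-b w₀ w₀∈ b₀<db k
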